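{- Let $r,n\ge1$ be integers, $c,d\in\mathbb{Z}$, $B_{c,d}$ the $r\times r$ matrix with diagonal entries $c$ and off-diagonal entries $d$, and $\mathscr{d}_1=\gcd(c-d,n)$. The number of $\boldsymbol{x}\in(\mathbb{Z}/n\mathbb{Z})^r$ such that $B_{c,d}\boldsymbol{x}\equiv a\cdot\boldsymbol{1}_r\pmod n$ for some $a\in\mathbb{Z}$ equals $n\,\mathscr{d}_1^{\,r-1}$.
   Context: $\boldsymbol{1}_r$ denotes the $r\times1$ column vector with all entries $1$. -}

module Defs where

open import Data.Nat as ℕ using (ℕ)
open import Data.Integer using (ℤ; +_; _+_; _-_; _*_; 0ℤ)
open import Data.Integer.Divisibility using (_∣_)
open import Data.Fin using (Fin; zero; suc; toℕ; _≟_)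
open import Data.Vec using (Vec; lookup)
open import Data.List using (List; length)
open import Data.List.Membership.Propositional using (_∈_)
open import Data.List.Relation.Unary.Unique.Propositional using (Unique)
open import Data.Product using (Σ; ∃; _×_)
open import Function.Bundles using (_⇔_)
open import Relation.Nullary using (yes; no)
open import Relation.Binary.PropositionalEquality using (_≡_)

sumFin : {r : ℕ} → (Fin r → ℤ) → ℤ
sumFin {ℕ.zero}  f = 0ℤ
sumFin {ℕ.suc r} f = f zero + sumFin (λ i → f (suc i))

B : (r : ℕ) → ℤ → ℤ → Fin r → Fin r → ℤ
B r c d i j with i ≟ j
... | yes _ = c
... | no  _ = d

mulVec : {r : ℕ} → (Fin r → Fin r → ℤ) → (Fin r → ℤ) → Fin r → ℤ
mulVec M x i = sumFin (λ j → M i j * x j)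

_≡_[mod_] : ℤ → ℤ → ℕ → Set
a ≡ b [mod n ] = (+ n) ∣ (a - b)

-- an element of (ℤ/nℤ)^r, represented by canonical residues 0..n-1, lifted to ℤ
liftVec : {r n : ℕ} → Vec (Fin n) r → Fin r → ℤ
liftVec x i = + toℕ (lookup x i)

Cond : (r n : ℕ) → ℤ → ℤ → Vec (Fin n) r → Set
Cond r n c d x = ∃ λ (a : ℤ) → ∀ (i : Fin r) → mulVec (B r c d) (liftVec x) i ≡ a [mod n ]

-- "the number of elements of A satisfying P is N": there is a duplicate-free
-- list of length N whose members are exactly the elements satisfying P.
HasCount : {A : Set} → (A → Set) → ℕ → Set
HasCount {A} P N = Σ (List A) λ xs → Unique xs × length xs ≡ N × (∀ x → (x ∈ xs) ⇔ P x)

-- B x = (c − d) x + d (Σ x) 1, so B x ≡ a 1 (mod n) for some a exactly when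
-- (c − d)(xᵢ − x₀) ≡ 0 (mod n) for every i.  With g = gcd(c − d, n) and k = n / g,
-- the factor (c − d)/g is a unit modulo k, so this says xᵢ ≡ x₀ (mod k) for every i.
-- Hence x₀ is arbitrary (n choices) and each of the other r − 1 entries lies in the
-- residue class of x₀ modulo k, which contains g elements of ℤ/nℤ.

module Submission where

module Counting where

  open import Defs using (HasCount)
  open import Data.Nat using (ℕ; zero; suc; _+_; _*_; _^_)
  open import Data.Fin using (Fin)
  open import Data.List using (List; []; _∷_; _++_; map; length; allFin)
  open import Data.List.Properties using (length-++; length-map; length-tabulate)
  open import Data.List.Membership.Propositional using (_∈_)
  open import Data.List.Membership.Propositional.Properties
    using (∈-map⁺; ∈-map⁻; ∈-++⁺ˡ; ∈-++⁺ʳ; ∈-++⁻; ∈-allFin)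
  open import Data.List.Relation.Unary.All as List using ()
  open import Data.List.Relation.Unary.Any using (here; there)
  open import Data.List.Relation.Unary.Unique.Propositional using (Unique)
  open import Data.List.Relation.Unary.AllPairs using ([]; _∷_)
  open import Data.List.Relation.Unary.Unique.Propositional.Properties using (map⁺; ++⁺; allFin⁺)
  open import Data.Vec using (Vec; []; _∷_; head; tail)
  open import Data.Vec.Properties using (∷-injectiveʳ)
  open import Data.Vec.Relation.Unary.All using (All; []; _∷_; uncons)
  open import Data.Empty using (⊥)
  open import Data.Unit using (⊤; tt)
  open import Data.Product using (∃; _×_; _,_; proj₁; uncurry)
  open import Data.Sum using (inj₁; inj₂)
  open import Function using (_∘_; id)
  open import Function.Definitions using (Injective)
  open import Function.Bundles using (_⇔_; mk⇔; Equivalence)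
  open import Function.Properties.Equivalence using () renaming (trans to ⇔-trans)
  open import Relation.Binary.PropositionalEquality using (_≡_; refl; sym; trans; cong; cong₂; module ≡-Reasoning)

  open Equivalence using (to; from)

  module _ {A : Set} where

    HasCount-⇔ : {P Q : A → Set} {N : ℕ} → (∀ x → P x ⇔ Q x) → HasCount P N → HasCount Q N
    HasCount-⇔ P⇔Q (xs , unique , length≡ , ∈⇔P) = xs , unique , length≡ , λ x → ⇔-trans (∈⇔P x) (P⇔Q x)

    HasCount-image : {P : A → Set} {N : ℕ} (f : Fin N → A) → Injective _≡_ _≡_ f →
                     (∀ x → P x ⇔ ∃ λ t → f t ≡ x) → HasCount P N
    HasCount-image {P} {N} f f-injective P⇔image =
      map f (allFin N) , map⁺ f-injective (allFin⁺ N) ,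
      trans (length-map f (allFin N)) (length-tabulate {n = N} id) ,
      λ x → mk⇔ (∈image⇒P x) (image⇒∈ x ∘ to (P⇔image x))
      where
      ∈image⇒P : ∀ x → x ∈ map f (allFin N) → P x
      ∈image⇒P x x∈ with ∈-map⁻ f x∈
      ... | t , _ , x≡ft = from (P⇔image x) (t , sym x≡ft)
      image⇒∈ : ∀ x → (∃ λ t → f t ≡ x) → x ∈ map f (allFin N)
      image⇒∈ x (t , refl) = ∈-map⁺ f (∈-allFin t)

  HasCount-Fin : ∀ n → HasCount (λ (_ : Fin n) → ⊤) n
  HasCount-Fin n = HasCount-image id id (λ i → mk⇔ (λ _ → i , refl) (λ _ → tt))

  module _ {A : Set} {m : ℕ} where

    consEach : List A → (A → List (Vec A m)) → List (Vec A (suc m))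
    consEach []       vss = []
    consEach (a ∷ as) vss = map (a ∷_) (vss a) ++ consEach as vss

    ∈-consEach⁻ : ∀ as vss {a v} → (a ∷ v) ∈ consEach as vss → a ∈ as × v ∈ vss a
    ∈-consEach⁻ (a′ ∷ as) vss p with ∈-++⁻ (map (a′ ∷_) (vss a′)) p
    ... | inj₁ q with ∈-map⁻ (a′ ∷_) q
    ...   | _ , v∈ , refl = here refl , v∈
    ∈-consEach⁻ (a′ ∷ as) vss p | inj₂ q with ∈-consEach⁻ as vss q
    ...   | a∈ , v∈ = there a∈ , v∈

    ∈-consEach⁺ : ∀ as vss {a v} → a ∈ as → v ∈ vss a → (a ∷ v) ∈ consEach as vss
    ∈-consEach⁺ (a ∷ as) vss (here refl) v∈ = ∈-++⁺ˡ (∈-map⁺ (a ∷_) v∈)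
    ∈-consEach⁺ (a ∷ as) vss (there a∈) v∈ = ∈-++⁺ʳ _ (∈-consEach⁺ as vss a∈ v∈)

    length-consEach : ∀ as vss {M} → (∀ a → length (vss a) ≡ M) → length (consEach as vss) ≡ length as * M
    length-consEach []       vss length≡ = refl
    length-consEach (a ∷ as) vss {M} length≡ = begin
      length (map (a ∷_) (vss a) ++ consEach as vss)       ≡⟨ length-++ (map (a ∷_) (vss a)) ⟩
      length (map (a ∷_) (vss a)) + length (consEach as vss) ≡⟨ cong₂ _+_ (trans (length-map _ (vss a)) (length≡ a))
                                                                           (length-consEach as vss length≡) ⟩
      M + length as * M                                    ∎
      where open ≡-Reasoning

    consEach⁺ : ∀ {as} vss → Unique as → (∀ a → Unique (vss a)) → Unique (consEach as vss)
    consEach⁺ vss [] _ = []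
    consEach⁺ {a ∷ as} vss (a∉as ∷ as!) vss! =
      ++⁺ (map⁺ ∷-injectiveʳ (vss! a)) (consEach⁺ vss as! vss!) disjoint
      where
      disjoint : ∀ {x} → x ∈ map (a ∷_) (vss a) × x ∈ consEach as vss → ⊥
      disjoint (p , q) with ∈-map⁻ (a ∷_) p
      ... | _ , _ , refl with ∈-consEach⁻ as vss q
      ...   | a∈as , _ = List.lookup a∉as a∈as refl

    HasCount-∷ : {P : A → Set} {Q : A → Vec A m → Set} {N M : ℕ} →
                 HasCount P N → (∀ a → HasCount (Q a) M) →
                 HasCount (λ x → P (head x) × Q (head x) (tail x)) (N * M)
    HasCount-∷ {P} {Q} {M = M} (as , as! , length-as , ∈as⇔P) countQ =
      consEach as vss , consEach⁺ vss as! vss! ,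
      trans (length-consEach as vss length-vss) (cong (_* M) length-as) ,
      λ { (a ∷ v) → mk⇔ (∈⇒PQ a v) (PQ⇒∈ a v) }
      where
      vss : A → List (Vec A m)
      vss a = proj₁ (countQ a)
      vss! : ∀ a → Unique (vss a)
      vss! a with countQ a
      ... | _ , unique , _ = unique
      length-vss : ∀ a → length (vss a) ≡ M
      length-vss a with countQ a
      ... | _ , _ , length≡ , _ = length≡
      ∈vss⇔Q : ∀ a v → v ∈ vss a ⇔ Q a v
      ∈vss⇔Q a with countQ a
      ... | _ , _ , _ , ∈⇔Q = ∈⇔Q
      ∈⇒PQ : ∀ a v → (a ∷ v) ∈ consEach as vss → P a × Q a v
      ∈⇒PQ a v p with ∈-consEach⁻ as vss p
      ... | a∈ , v∈ = to (∈as⇔P a) a∈ , to (∈vss⇔Q a v) v∈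
      PQ⇒∈ : ∀ a v → P a × Q a v → (a ∷ v) ∈ consEach as vss
      PQ⇒∈ a v (Pa , Qav) = ∈-consEach⁺ as vss (from (∈as⇔P a) Pa) (from (∈vss⇔Q a v) Qav)

  module _ {A : Set} {P : A → Set} {N : ℕ} where

    HasCount-All : HasCount P N → ∀ m → HasCount (All P {m}) (N ^ m)
    HasCount-All countP zero    = [] ∷ [] , List.[] ∷ [] , refl , λ { [] → mk⇔ (λ _ → []) (λ _ → here refl) }
    HasCount-All countP (suc m) =
      HasCount-⇔ (λ { (a ∷ v) → mk⇔ (uncurry _∷_) uncons }) (HasCount-∷ countP (λ _ → HasCount-All countP m))

module Arithmetic where

  open import Defs using (HasCount)
  open Counting using (HasCount-image)
  open import Data.Nat using (ℕ; suc; _+_; _*_; _∸_; _<_; _≤_; NonZero; ∣_-_∣)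
  open import Data.Nat.Properties
    using ( ≤-total; m≤n⇒∣m-n∣≡n∸m; m≤n⇒∣n-m∣≡n∸m; [m+n]∸[m+o]≡n∸o; *-distribʳ-∸; m∸n+n≡m
          ; *-assoc; *-comm; +-monoˡ-<; *-monoˡ-≤; *-cancelʳ-≡; +-cancelˡ-≡; module ≤-Reasoning )
  open import Data.Nat.DivMod
    using (_%_; _/_; m%n<n; m≡m%n+[m/n]*n; [m+kn]%n≡m%n; m%n%n≡m%n; %-remove-+ˡ; m<n*o⇒m/o<n; m/n*n≡m)
  open import Data.Nat.Divisibility using (_∣_; divides; *-cancelʳ-∣; *-monoˡ-∣; ∣n⇒∣m*n)
  open import Data.Nat.GCD using (gcd; gcd[m,n]∣m; gcd[m,n]∣n)
  open import Data.Nat.Coprimality using (coprime-/gcd; coprime-divisor) renaming (sym to Coprime-sym)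
  open import Data.Fin using (Fin; toℕ; fromℕ<)
  open import Data.Fin.Properties using (toℕ-fromℕ<; toℕ-injective; toℕ<n)
  import Data.Integer as ℤ
  open import Data.Integer.Properties using ([+m]-[+n]≡m⊖n; ∣⊖∣-≤; ∣m⊖n∣≡∣n⊖m∣)
  open import Data.Product using (∃; _,_)
  open import Data.Sum using (inj₁; inj₂)
  open import Function.Bundles using (_⇔_; mk⇔)
  open import Function.Definitions using (Injective)
  open import Function.Properties.Equivalence using () renaming (trans to ⇔-trans)
  open import Relation.Binary.PropositionalEquality

  ∣[+m]-[+n]∣≡∣m-n∣ : ∀ m n → ℤ.∣ ℤ.+ m ℤ.- ℤ.+ n ∣ ≡ ∣ m - n ∣
  ∣[+m]-[+n]∣≡∣m-n∣ m n with ≤-total m n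
  ... | inj₁ m≤n = begin
    ℤ.∣ ℤ.+ m ℤ.- ℤ.+ n ∣ ≡⟨ cong ℤ.∣_∣ ([+m]-[+n]≡m⊖n m n) ⟩
    ℤ.∣ m ℤ.⊖ n ∣         ≡⟨ ∣⊖∣-≤ m≤n ⟩
    n ∸ m                 ≡⟨ m≤n⇒∣m-n∣≡n∸m m≤n ⟨
    ∣ m - n ∣             ∎
    where open ≡-Reasoning
  ... | inj₂ n≤m = begin
    ℤ.∣ ℤ.+ m ℤ.- ℤ.+ n ∣ ≡⟨ cong ℤ.∣_∣ ([+m]-[+n]≡m⊖n m n) ⟩
    ℤ.∣ m ℤ.⊖ n ∣         ≡⟨ ∣m⊖n∣≡∣n⊖m∣ m n ⟩
    ℤ.∣ n ℤ.⊖ m ∣         ≡⟨ ∣⊖∣-≤ n≤m ⟩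
    m ∸ n                 ≡⟨ m≤n⇒∣n-m∣≡n∸m n≤m ⟨
    ∣ m - n ∣             ∎
    where open ≡-Reasoning

  module _ (k : ℕ) .{{_ : NonZero k}} where

    %≡%⇔∣∸ : ∀ {m n} → n ≤ m → m % k ≡ n % k ⇔ k ∣ m ∸ n
    %≡%⇔∣∸ {m} {n} n≤m = mk⇔ to from
      where
      to : m % k ≡ n % k → k ∣ m ∸ n
      to m%k≡n%k = divides (m / k ∸ n / k) (begin
        m ∸ n                                       ≡⟨ cong₂ _∸_ (m≡m%n+[m/n]*n m k) (m≡m%n+[m/n]*n n k) ⟩
        (m % k + m / k * k) ∸ (n % k + n / k * k)   ≡⟨ cong (λ r → (r + m / k * k) ∸ (n % k + n / k * k)) m%k≡n%k ⟩
        (n % k + m / k * k) ∸ (n % k + n / k * k)   ≡⟨ [m+n]∸[m+o]≡n∸o (n % k) _ _ ⟩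
        m / k * k ∸ n / k * k                       ≡⟨ *-distribʳ-∸ k (m / k) (n / k) ⟨
        (m / k ∸ n / k) * k                         ∎)
        where open ≡-Reasoning
      from : k ∣ m ∸ n → m % k ≡ n % k
      from k∣m∸n = trans (cong (_% k) (sym (m∸n+n≡m n≤m))) (%-remove-+ˡ n k∣m∸n)

    %≡%⇔∣∣-∣ : ∀ m n → m % k ≡ n % k ⇔ k ∣ ∣ m - n ∣
    %≡%⇔∣∣-∣ m n with ≤-total n m
    ... | inj₁ n≤m = subst (λ d → m % k ≡ n % k ⇔ k ∣ d) (sym (m≤n⇒∣n-m∣≡n∸m n≤m)) (%≡%⇔∣∸ n≤m)
    ... | inj₂ m≤n = subst (λ d → m % k ≡ n % k ⇔ k ∣ d) (sym (m≤n⇒∣m-n∣≡n∸m m≤n))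
                           (⇔-trans (mk⇔ sym sym) (%≡%⇔∣∸ m≤n))

  module _ (m n : ℕ) .{{_ : NonZero (gcd m n)}} where

    ∣*⇔/gcd∣ : ∀ D → n ∣ m * D ⇔ n / gcd m n ∣ D
    ∣*⇔/gcd∣ D = mk⇔ to from
      where
      g k m′ : ℕ
      g = gcd m n
      k = n / g
      m′ = m / g
      k*g≡n : k * g ≡ n
      k*g≡n = m/n*n≡m (gcd[m,n]∣n m n)
      m*D≡m′*[D*g] : m * D ≡ m′ * (D * g)
      m*D≡m′*[D*g] = begin
        m * D          ≡⟨ cong (_* D) (m/n*n≡m (gcd[m,n]∣m m n)) ⟨
        m′ * g * D     ≡⟨ *-assoc m′ g D ⟩
        m′ * (g * D)   ≡⟨ cong (m′ *_) (*-comm g D) ⟩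
        m′ * (D * g)   ∎
        where open ≡-Reasoning
      to : n ∣ m * D → k ∣ D
      to n∣m*D = coprime-divisor (Coprime-sym (coprime-/gcd m n)) (*-cancelʳ-∣ g k*g∣m′*D*g)
        where
        k*g∣m′*D*g : k * g ∣ m′ * D * g
        k*g∣m′*D*g = subst₂ _∣_ (sym k*g≡n) (trans m*D≡m′*[D*g] (sym (*-assoc m′ D g))) n∣m*D
      from : k ∣ D → n ∣ m * D
      from k∣D = subst₂ _∣_ k*g≡n (sym m*D≡m′*[D*g]) (∣n⇒∣m*n m′ (*-monoˡ-∣ g k∣D))

  module _ {n k g : ℕ} .{{_ : NonZero k}} (g*k≡n : g * k ≡ n) (a : ℕ) where

    residueClass-HasCount : HasCount (λ (b : Fin n) → toℕ b % k ≡ a % k) g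
    residueClass-HasCount =
      HasCount-image member member-injective (λ b → mk⇔ (inClass⇒member b) (member⇒inClass b))
      where
      a%k+t*k<n : (t : Fin g) → a % k + toℕ t * k < n
      a%k+t*k<n t = begin-strict
        a % k + toℕ t * k  <⟨ +-monoˡ-< (toℕ t * k) (m%n<n a k) ⟩
        suc (toℕ t) * k    ≤⟨ *-monoˡ-≤ k (toℕ<n t) ⟩
        g * k              ≡⟨ g*k≡n ⟩
        n                  ∎
        where open ≤-Reasoning
      member : Fin g → Fin n
      member t = fromℕ< (a%k+t*k<n t)
      member-injective : Injective _≡_ _≡_ member
      member-injective {s} {t} eq = toℕ-injective (*-cancelʳ-≡ (toℕ s) (toℕ t) k (+-cancelˡ-≡ (a % k) _ _
        (trans (sym (toℕ-fromℕ< (a%k+t*k<n s))) (trans (cong toℕ eq) (toℕ-fromℕ< (a%k+t*k<n t))))))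
      inClass⇒member : ∀ b → toℕ b % k ≡ a % k → ∃ λ t → member t ≡ b
      inClass⇒member b b%k≡a%k = t , toℕ-injective (begin
        toℕ (member t)             ≡⟨ toℕ-fromℕ< (a%k+t*k<n t) ⟩
        a % k + toℕ t * k          ≡⟨ cong₂ _+_ b%k≡a%k (cong (_* k) (sym (toℕ-fromℕ< b/k<g))) ⟨
        toℕ b % k + toℕ b / k * k  ≡⟨ m≡m%n+[m/n]*n (toℕ b) k ⟨
        toℕ b                      ∎)
        where
        open ≡-Reasoning
        b/k<g : toℕ b / k < g
        b/k<g = m<n*o⇒m/o<n (subst (toℕ b <_) (sym g*k≡n) (toℕ<n b))
        t : Fin g
        t = fromℕ< b/k<g
      member⇒inClass : ∀ b → (∃ λ t → member t ≡ b) → toℕ b % k ≡ a % k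
      member⇒inClass _ (t , refl) = begin
        toℕ (member t) % k         ≡⟨ cong (_% k) (toℕ-fromℕ< (a%k+t*k<n t)) ⟩
        (a % k + toℕ t * k) % k    ≡⟨ [m+kn]%n≡m%n (a % k) (toℕ t) k ⟩
        a % k % k                  ≡⟨ m%n%n≡m%n a k ⟩
        a % k                      ∎
        where open ≡-Reasoning

module Matrix where

  open import Defs
  open import Data.Nat using (zero; suc)
  open import Data.Integer using (ℤ; _+_; _-_; _*_)
  open import Data.Integer.Properties using (*-zeroʳ; *-distribˡ-+)
  open import Data.Integer.Tactic.RingSolver using (solve-∀)
  open import Data.Fin using (Fin; zero; suc; _≟_)
  open import Function using (_∘_)
  open import Relation.Nullary using (yes; no)
  open import Relation.Binary.PropositionalEquality

  sumFin-cong : ∀ {r} {f h : Fin r → ℤ} → (∀ j → f j ≡ h j) → sumFin f ≡ sumFin h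
  sumFin-cong {zero}  f≗h = refl
  sumFin-cong {suc r} f≗h = cong₂ _+_ (f≗h zero) (sumFin-cong (f≗h ∘ suc))

  sumFin-*-distribˡ : ∀ {r} d (f : Fin r → ℤ) → sumFin (λ j → d * f j) ≡ d * sumFin f
  sumFin-*-distribˡ {zero}  d f = sym (*-zeroʳ d)
  sumFin-*-distribˡ {suc r} d f = begin
    d * f zero + sumFin (λ j → d * f (suc j)) ≡⟨ cong (λ s → d * f zero + s) (sumFin-*-distribˡ d (f ∘ suc)) ⟩
    d * f zero + d * sumFin (f ∘ suc)          ≡⟨ *-distribˡ-+ d (f zero) _ ⟨
    d * sumFin f                               ∎
    where open ≡-Reasoning

  B-suc-suc : ∀ r c d (i j : Fin r) → B (suc r) c d (suc i) (suc j) ≡ B r c d i j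
  B-suc-suc r c d i j with i ≟ j
  ... | yes _ = refl
  ... | no  _ = refl

  mulVec-B : ∀ r c d (x : Fin r → ℤ) i → mulVec (B r c d) x i ≡ (c - d) * x i + d * sumFin x
  mulVec-B (suc r) c d x zero = begin
    c * x zero + sumFin (λ j → d * x (suc j)) ≡⟨ cong (λ s → c * x zero + s) (sumFin-*-distribˡ d (x ∘ suc)) ⟩
    c * x zero + d * sumFin (x ∘ suc)          ≡⟨ regroup c d (x zero) (sumFin (x ∘ suc)) ⟩
    (c - d) * x zero + d * sumFin x            ∎
    where
    open ≡-Reasoning
    regroup : ∀ c d x₀ s → c * x₀ + d * s ≡ (c - d) * x₀ + d * (x₀ + s)
    regroup = solve-∀
  mulVec-B (suc r) c d x (suc i) = begin
    d * x zero + sumFin (λ j → B (suc r) c d (suc i) (suc j) * x (suc j))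
      ≡⟨ cong (λ s → d * x zero + s) (sumFin-cong (λ j → cong (_* x (suc j)) (B-suc-suc r c d i j))) ⟩
    d * x zero + mulVec (B r c d) (x ∘ suc) i
      ≡⟨ cong (λ s → d * x zero + s) (mulVec-B r c d (x ∘ suc) i) ⟩
    d * x zero + ((c - d) * x (suc i) + d * sumFin (x ∘ suc))
      ≡⟨ regroup c d (x zero) (x (suc i)) (sumFin (x ∘ suc)) ⟩
    (c - d) * x (suc i) + d * sumFin x
      ∎
    where
    open ≡-Reasoning
    regroup : ∀ c d x₀ xᵢ s → d * x₀ + ((c - d) * xᵢ + d * s) ≡ (c - d) * xᵢ + d * (x₀ + s)
    regroup = solve-∀

  mulVec-B-∸ : ∀ r c d (x : Fin r → ℤ) i j →
               mulVec (B r c d) x i - mulVec (B r c d) x j ≡ (c - d) * (x i - x j)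
  mulVec-B-∸ r c d x i j = trans (cong₂ _-_ (mulVec-B r c d x i) (mulVec-B r c d x j))
                                 (cancel (c - d) (x i) (x j) d (sumFin x))
    where
    cancel : ∀ e p q d s → (e * p + d * s) - (e * q + d * s) ≡ e * (p - q)
    cancel = solve-∀

module Solutions where

  open import Defs
  open Counting
  open Arithmetic
  open Matrix
  open import Data.Nat as ℕ using (ℕ; suc; NonZero; ≢-nonZero; ≢-nonZero⁻¹; _%_; _/_)
  open import Data.Nat.GCD using (gcd; gcd[m,n]∣n; gcd[m,n]≢0; n/gcd[m,n]≢0)
  open import Data.Nat.DivMod using (m*[n/m]≡n)
  open import Data.Nat.Divisibility using () renaming (_∣_ to _∣ℕ_)
  open import Data.Integer using (ℤ; +_; ∣_∣; _-_; _*_)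
  open import Data.Integer.Properties using (abs-*)
  open import Data.Integer.Divisibility using (_∣_)
  import Data.Integer.Divisibility.Signed as Signed
  open import Data.Integer.Tactic.RingSolver using (solve-∀)
  open import Data.Fin using (Fin; zero; suc; toℕ)
  open import Data.Vec using (Vec; _∷_; head; tail; lookup)
  open import Data.Vec.Relation.Unary.All using (All; _∷_)
  open import Data.Vec.Relation.Unary.All.Properties using (lookup⁺; lookup⁻)
  open import Data.Product using (∃; _,_; proj₂)
  open import Data.Unit using (tt)
  open import Data.Sum using (inj₂)
  open import Function using (_∘_)
  open import Function.Bundles using (_⇔_; mk⇔; Equivalence)
  open import Function.Properties.Equivalence using (⇔-setoid) renaming (sym to ⇔-sym; trans to ⇔-trans)
  open import Relation.Binary.PropositionalEquality
  import Relation.Binary.Reasoning.Setoid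
  open import Level using (0ℓ)

  open Equivalence using (to; from)

  module ⇔-Reasoning = Relation.Binary.Reasoning.Setoid (⇔-setoid 0ℓ)

  ∃≡[mod]⇔≡[mod]first : ∀ {r n} (v : Fin (suc r) → ℤ) →
                        (∃ λ a → ∀ i → v i ≡ a [mod n ]) ⇔ (∀ i → v i ≡ v zero [mod n ])
  ∃≡[mod]⇔≡[mod]first {n = n} v = mk⇔ ≡first (λ h → v zero , h)
    where
    cancel : ∀ p q a → (p - a) - (q - a) ≡ p - q
    cancel = solve-∀
    ≡first : (∃ λ a → ∀ i → v i ≡ a [mod n ]) → ∀ i → v i ≡ v zero [mod n ]
    ≡first (a , h) i = Signed.∣⇒∣ᵤ (subst (+ n Signed.∣_) (cancel (v i) (v zero) a)
      (Signed.∣m∣n⇒∣m-n (Signed.∣ᵤ⇒∣ {i = v i - a} (h i)) (Signed.∣ᵤ⇒∣ {i = v zero - a} (h zero))))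

  ∀-cong-⇔ : ∀ {I : Set} {P Q : I → Set} → (∀ i → P i ⇔ Q i) → (∀ i → P i) ⇔ (∀ i → Q i)
  ∀-cong-⇔ P⇔Q = mk⇔ (λ h i → to (P⇔Q i) (h i)) (λ h i → from (P⇔Q i) (h i))

  ∀lookup∷⇔All : ∀ {A : Set} {P : A → Set} {m a} {v : Vec A m} → P a →
                 (∀ i → P (lookup (a ∷ v) i)) ⇔ All P v
  ∀lookup∷⇔All Pa = mk⇔ (λ h → lookup⁻ (h ∘ suc)) (λ all → lookup⁺ (Pa ∷ all))

  module _ (n : ℕ) .{{_ : NonZero n}} (c d : ℤ) where

    private instance
      gcd-nonZero : NonZero (gcd ∣ c - d ∣ n)
      gcd-nonZero = ≢-nonZero (gcd[m,n]≢0 ∣ c - d ∣ n (inj₂ (≢-nonZero⁻¹ n)))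

    k : ℕ
    k = n / gcd ∣ c - d ∣ n

    private instance
      k-nonZero : NonZero k
      k-nonZero = ≢-nonZero (n/gcd[m,n]≢0 ∣ c - d ∣ n)

    ∣*[+x-+y]⇔%≡% : ∀ x y → + n ∣ (c - d) * (+ x - + y) ⇔ x % k ≡ y % k
    ∣*[+x-+y]⇔%≡% x y = begin
      n ∣ℕ ∣ (c - d) * (+ x - + y) ∣         ≡⟨ cong (n ∣ℕ_) (abs-* (c - d) (+ x - + y)) ⟩
      n ∣ℕ (∣ c - d ∣ ℕ.* ∣ + x - + y ∣)     ≈⟨ ∣*⇔/gcd∣ (∣ c - d ∣) n (∣ + x - + y ∣) ⟩
      k ∣ℕ ∣ + x - + y ∣                     ≡⟨ cong (k ∣ℕ_) (∣[+m]-[+n]∣≡∣m-n∣ x y) ⟩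
      k ∣ℕ ℕ.∣ x - y ∣                       ≈⟨ ⇔-sym (%≡%⇔∣∣-∣ k x y) ⟩
      x % k ≡ y % k                          ∎
      where open ⇔-Reasoning

    gcd*k≡n : gcd ∣ c - d ∣ n ℕ.* k ≡ n
    gcd*k≡n = m*[n/m]≡n (gcd[m,n]∣n ∣ c - d ∣ n)

    Cond⇔inClassOfHead : ∀ {r} (x : Vec (Fin n) (suc r)) →
                         Cond (suc r) n c d x ⇔ All (λ b → toℕ b % k ≡ toℕ (head x) % k) (tail x)
    Cond⇔inClassOfHead {r} x@(a ∷ v) = begin
      Cond (suc r) n c d x                       ≈⟨ ∃≡[mod]⇔≡[mod]first (M x) ⟩
      (∀ i → M x i ≡ M x zero [mod n ])          ≈⟨ ∀-cong-⇔ congruent⇔inClass ⟩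
      (∀ i → toℕ (lookup x i) % k ≡ toℕ a % k)   ≈⟨ ∀lookup∷⇔All refl ⟩
      All (λ b → toℕ b % k ≡ toℕ a % k) v        ∎
      where
      open ⇔-Reasoning
      M : Vec (Fin n) (suc r) → Fin (suc r) → ℤ
      M x = mulVec (B (suc r) c d) (liftVec x)
      congruent⇔inClass : ∀ i → M x i ≡ M x zero [mod n ] ⇔ toℕ (lookup x i) % k ≡ toℕ a % k
      congruent⇔inClass i = begin
        (+ n ∣ M x i - M x zero)                        ≡⟨ cong (+ n ∣_) (mulVec-B-∸ (suc r) c d (liftVec x) i zero) ⟩
        (+ n ∣ (c - d) * (liftVec x i - liftVec x zero)) ≈⟨ ∣*[+x-+y]⇔%≡% (toℕ (lookup x i)) (toℕ a) ⟩
        toℕ (lookup x i) % k ≡ toℕ a % k              ∎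

    Cond-HasCount : ∀ r → HasCount (Cond (suc r) n c d) (n ℕ.* gcd ∣ c - d ∣ n ℕ.^ r)
    Cond-HasCount r =
      HasCount-⇔ (λ x → ⇔-sym (⇔-trans (Cond⇔inClassOfHead x) (mk⇔ (tt ,_) proj₂)))
        (HasCount-∷ (HasCount-Fin n) (λ a → HasCount-All (residueClass-HasCount gcd*k≡n (toℕ a)) r))

open import Defs using (HasCount; Cond)
open import Data.Nat using (ℕ; suc; _≤_; _∸_; _^_; _*_)
open import Data.Nat.GCD using (gcd)
open import Data.Integer using (ℤ; ∣_∣; _-_)

corollary4p5 : (r n : ℕ) → 1 ≤ r → 1 ≤ n → (c d : ℤ) →
    HasCount (Cond r n c d) (n * gcd ∣ c - d ∣ n ^ (r ∸ 1))
corollary4p5 (suc r) n@(suc _) _ _ c d = Solutions.Cond-HasCount n c d r
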